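{- In any instance of unweighted 3TAP on $n$ vertices, every feasible solution $A$ satisfies $|A|\ge\frac{n-1}{2}$.
   Context: Unweighted 3TAP: given a tree $T$ on vertex set $V$ with $|V|=n$ and a set of available links (vertex pairs not in $T$), each of cost $1$ (non-available pairs have infinite cost), find a minimum-size set $A$ of available links such that every tree edge lies in a cycle of length $3$ in $(V,E(T)\cup A)$. The cost of a feasible solution $A$ is $|A|$. -}

module Defs where

open import Data.Nat using (ℕ; _≤_; _*_; _∸_)
open import Data.Fin using (Fin)
open import Data.List using (List; []; _∷_; _++_; length)
open import Data.List.Membership.Propositional using (_∈_)
open import Data.List.Relation.Unary.All using (All)
open import Data.List.Relation.Unary.AllPairs using (AllPairs)
open import Data.List.Relation.Unary.Unique.Propositional using (Unique)
open import Data.Product using (_×_; _,_; ∃; proj₁; proj₂)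
open import Data.Unit using (⊤)
open import Data.Empty using (⊥)
open import Data.List.Relation.Unary.Any using (Any)
open import Data.Sum using (_⊎_)
open import Relation.Binary.PropositionalEquality using (_≡_; _≢_)
open import Relation.Nullary using (¬_)

-- A (multi)graph on vertex set Fin n is given by a list of edges; each
-- pair (u , v) represents the unordered edge {u , v}.
EdgeList : ℕ → Set
EdgeList n = List (Fin n × Fin n)

Adj : ∀ {n} → EdgeList n → Fin n → Fin n → Set
Adj E u v = (u , v) ∈ E ⊎ (v , u) ∈ E

SameEdge : ∀ {n} → Fin n × Fin n → Fin n × Fin n → Set
SameEdge (a , b) (c , d) = (a ≡ c × b ≡ d) ⊎ (a ≡ d × b ≡ c)

Simple : ∀ {n} → EdgeList n → Set
Simple E = All (λ e → proj₁ e ≢ proj₂ e) E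
         × AllPairs (λ e f → ¬ SameEdge e f) E

data Walk {n} (E : EdgeList n) : Fin n → Fin n → Set where
  here : ∀ {u} → Walk E u u
  step : ∀ {u w v} → Adj E u w → Walk E w v → Walk E u v

Connected : ∀ {n} → EdgeList n → Set
Connected {n} E = (u v : Fin n) → Walk E u v

ClosedPath : ∀ {n} → EdgeList n → Fin n → List (Fin n) → Set
ClosedPath E first [] = ⊤
ClosedPath E first (x ∷ []) = Adj E x first
ClosedPath E first (x ∷ y ∷ xs) = Adj E x y × ClosedPath E first (y ∷ xs)

IsCycle : ∀ {n} → EdgeList n → List (Fin n) → Set
IsCycle E [] = ⊥
IsCycle E (x ∷ xs) = 3 ≤ length (x ∷ xs) × Unique (x ∷ xs) × ClosedPath E x (x ∷ xs)

Acyclic : ∀ {n} → EdgeList n → Set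
Acyclic E = ∀ cs → ¬ IsCycle E cs

IsTree : ∀ {n} → EdgeList n → Set
IsTree T = Simple T × Connected T × Acyclic T

-- an instance of unweighted 3TAP: tree T and the set L of available links
-- (vertex pairs not in T; all other pairs have infinite cost)
record Instance (n : ℕ) : Set where
  field
    T       : EdgeList n
    L       : EdgeList n
    isTree  : IsTree T
    L-simple : Simple L
    L-notInT : All (λ ℓ → All (λ e → ¬ SameEdge ℓ e) T) L

InTriangle : ∀ {n} → EdgeList n → Fin n × Fin n → Set
InTriangle G (u , v) = ∃ λ w → w ≢ u × w ≢ v × Adj G u w × Adj G w v

Feasible : ∀ {n} → Instance n → EdgeList n → Set
Feasible I A = Simple A
             × All (λ a → Any (SameEdge a) (Instance.L I)) A
             × All (InTriangle (Instance.T I ++ A)) (Instance.T I)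

-- Replace every link {x, y} of A by at most two edges: the path x – z – y
-- through a common tree neighbour z if there is one, and the edge x y itself
-- otherwise. Since a tree has no cycles of length 3 or 4, a common tree
-- neighbour of two distinct vertices is unique, and every triangle covering a
-- tree edge {u, v} contains a link; hence u and v are joined in the new
-- multigraph H. So H is connected, and a connected multigraph on n vertices has
-- at least n − 1 edges, giving n − 1 ≤ |H| ≤ 2 |A|.
module Submission where

open import Defs
open import Data.Nat using (ℕ; zero; suc; _+_; _*_; _∸_; _≤_; z≤n; s≤s)
open import Data.Nat.Properties
  using (≤-refl; ≤-reflexive; ≤-trans; n≤1+n; ≤-pred; +-suc; +-identityʳ; +-monoˡ-≤; +-mono-≤;
         *-suc; module ≤-Reasoning)
open import Data.Fin using (Fin) renaming (zero to fzero; suc to fsuc)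
open import Data.Fin.Properties using (_≟_; any?)
open import Data.Fin.Subset using (Subset; inside; outside; ⊤; ⁅_⁆; _─_; _-_; ∣_∣; _∉_)
  renaming (_∈_ to _∈ˢ_; _⊆_ to _⊆ˢ_)
open import Data.Fin.Subset.Properties
  using (∈⊤; ∣⊤∣≡n; ∣⁅x⁆∣≡1; x∈⁅x⁆; x≢y⇒x∉⁅y⁆; x∉⁅y⁆⇒x≢y; p⊆q⇒∣p∣≤∣q∣; p─⊥≡p;
         p─q⊆p; x∈p∧x∉q⇒x∈p─q)
open import Data.List using ([]; _∷_; _++_; length; concatMap)
open import Data.Vec using (_∷_; here; there)
open import Data.List.Properties using (length-++)
open import Data.List.Membership.Propositional using (_∈_)
open import Data.List.Membership.Propositional.Properties using (∈-++⁻; ∈-concatMap⁺)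
import Data.List.Membership.DecPropositional as DecMembership
open import Data.List.Relation.Binary.Subset.Propositional using (_⊆_)
open import Data.List.Relation.Unary.All using (All; []; _∷_; lookup)
open import Data.List.Relation.Unary.AllPairs using ([]; _∷_)
open import Data.List.Relation.Unary.Any using (here; there)
import Data.List.Relation.Unary.Any as Any
open import Data.Product using (_×_; _,_; proj₁; proj₂; swap)
open import Data.Product.Properties using (≡-dec)
open import Data.Sum using (_⊎_; inj₁; inj₂)
open import Data.Empty using (⊥; ⊥-elim)
open import Relation.Nullary using (Dec; yes; no)
open import Relation.Nullary.Decidable using (_×-dec_; _⊎-dec_)
open import Relation.Binary.PropositionalEquality using (_≡_; _≢_; refl; sym; trans; cong; subst)
open import Function using (_∘_)

∣p∣≤1+∣p-x∣ : ∀ {n} (p : Subset n) x → ∣ p ∣ ≤ suc ∣ p - x ∣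
∣p∣≤1+∣p-x∣ (inside  ∷ p) fzero = s≤s (≤-reflexive (cong ∣_∣ (sym (p─⊥≡p p))))
∣p∣≤1+∣p-x∣ (outside ∷ p) fzero = ≤-trans (≤-reflexive (cong ∣_∣ (sym (p─⊥≡p p)))) (n≤1+n _)
∣p∣≤1+∣p-x∣ (inside  ∷ p) (fsuc x) = s≤s (∣p∣≤1+∣p-x∣ p x)
∣p∣≤1+∣p-x∣ (outside ∷ p) (fsuc x) = ∣p∣≤1+∣p-x∣ p x

x∈p─q⇒x∉q : ∀ {n} {p q : Subset n} {x} → x ∈ˢ p ─ q → x ∉ q
x∈p─q⇒x∉q {p = _ ∷ _} {q = outside ∷ _} here         ()
x∈p─q⇒x∉q {p = _ ∷ _} {q = _ ∷ _}       (there x∈p─q) (there x∈q) = x∈p─q⇒x∉q x∈p─q x∈q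

module _ {n} {E : EdgeList n} where

  Adj-sym : ∀ {a b} → Adj E a b → Adj E b a
  Adj-sym = Data.Sum.swap

  infixr 5 _++ʷ_

  _++ʷ_ : ∀ {a b c} → Walk E a b → Walk E b c → Walk E a c
  here       ++ʷ q = q
  step ab p  ++ʷ q = step ab (p ++ʷ q)

  Adj⇒Walk : ∀ {a b} → Adj E a b → Walk E a b
  Adj⇒Walk ab = step ab here

  reverseʷ : ∀ {a b} → Walk E a b → Walk E b a
  reverseʷ here       = here
  reverseʷ (step ab p) = reverseʷ p ++ʷ Adj⇒Walk (Adj-sym ab)

  Adj-mono : ∀ {F} → E ⊆ F → ∀ {a b} → Adj E a b → Adj F a b
  Adj-mono E⊆F (inj₁ ab) = inj₁ (E⊆F ab)
  Adj-mono E⊆F (inj₂ ba) = inj₂ (E⊆F ba)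

Walk-bind : ∀ {n} {E F : EdgeList n} → (∀ {a b} → Adj E a b → Walk F a b) →
            ∀ {a b} → Walk E a b → Walk F a b
Walk-bind f here        = here
Walk-bind f (step ab p) = f ab ++ʷ Walk-bind f p

Walk-mono : ∀ {n} {E F : EdgeList n} → E ⊆ F → ∀ {a b} → Walk E a b → Walk F a b
Walk-mono E⊆F = Walk-bind (Adj⇒Walk ∘ Adj-mono E⊆F)

-- Union–find: each vertex is labelled by the root of its current component. Adding an
-- edge deletes at most one root, which is why `size` is preserved.
record RootLabelling {n} (H : EdgeList n) : Set where
  field
    roots       : Subset n
    label       : Fin n → Fin n
    label∈roots : ∀ x → label x ∈ˢ roots
    label-root  : ∀ {r} → r ∈ˢ roots → label r ≡ r
    label-edge  : ∀ {a b} → (a , b) ∈ H → label a ≡ label b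
    size        : n ≤ ∣ roots ∣ + length H

  label-walk : ∀ {a b} → Walk H a b → label a ≡ label b
  label-walk here               = refl
  label-walk (step (inj₁ ab) p) = trans (label-edge ab) (label-walk p)
  label-walk (step (inj₂ ba) p) = trans (sym (label-edge ba)) (label-walk p)

redirect : ∀ {n} → Fin n → Fin n → Fin n → Fin n
redirect q p y with y ≟ q
... | yes _ = p
... | no  _ = y

redirect-source : ∀ {n} (q p : Fin n) → redirect q p q ≡ p
redirect-source q p with q ≟ q
... | yes _   = refl
... | no  q≢q = ⊥-elim (q≢q refl)

redirect-other : ∀ {n} {q y : Fin n} p → y ≢ q → redirect q p y ≡ y
redirect-other {q = q} {y} p y≢q with y ≟ q
... | yes y≡q = ⊥-elim (y≢q y≡q)
... | no  _   = refl

module _ {n} {H : EdgeList n} (L : RootLabelling H) (u v : Fin n) where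
  open RootLabelling L

  absorb : label u ≡ label v → RootLabelling ((u , v) ∷ H)
  absorb lu≡lv = record
    { roots       = roots
    ; label       = label
    ; label∈roots = label∈roots
    ; label-root  = label-root
    ; label-edge  = λ { (here refl) → lu≡lv ; (there ab) → label-edge ab }
    ; size        = ≤-trans size (≤-trans (n≤1+n _) (≤-reflexive (sym (+-suc _ (length H)))))
    }

  merge : label u ≢ label v → RootLabelling ((u , v) ∷ H)
  merge lu≢lv = record
    { roots       = roots - label v
    ; label       = label′
    ; label∈roots = label′∈roots′
    ; label-root  = label′-root
    ; label-edge  = label′-edge
    ; size        = ≤-trans size (≤-trans (+-monoˡ-≤ (length H) (∣p∣≤1+∣p-x∣ roots (label v)))
                                          (≤-reflexive (sym (+-suc _ (length H)))))
    }
    where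
    label′ : Fin n → Fin n
    label′ x = redirect (label v) (label u) (label x)

    survives : ∀ x → label x ≢ label v → label x ∈ˢ roots - label v
    survives x ne = x∈p∧x∉q⇒x∈p─q (label∈roots x) (x≢y⇒x∉⁅y⁆ ne)

    label′∈roots′ : ∀ x → label′ x ∈ˢ roots - label v
    label′∈roots′ x with label x ≟ label v
    ... | yes _  = survives u lu≢lv
    ... | no  ne = survives x ne

    label′-root : ∀ {r} → r ∈ˢ roots - label v → label′ r ≡ r
    label′-root {r} r∈ rewrite label-root (p─q⊆p roots ⁅ label v ⁆ r∈) =
      redirect-other (label u) (x∉⁅y⁆⇒x≢y (x∈p─q⇒x∉q r∈))

    label′-edge : ∀ {a b} → (a , b) ∈ (u , v) ∷ H → label′ a ≡ label′ b
    label′-edge (here refl) =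
      trans (redirect-other (label u) lu≢lv) (sym (redirect-source (label v) (label u)))
    label′-edge (there ab)  = cong (redirect (label v) (label u)) (label-edge ab)

  addEdge : RootLabelling ((u , v) ∷ H)
  addEdge with label u ≟ label v
  ... | yes lu≡lv = absorb lu≡lv
  ... | no  lu≢lv = merge lu≢lv

rootLabelling : ∀ {n} (H : EdgeList n) → RootLabelling H
rootLabelling {n} [] = record
  { roots       = ⊤
  ; label       = λ x → x
  ; label∈roots = λ _ → ∈⊤
  ; label-root  = λ _ → refl
  ; label-edge  = λ ()
  ; size        = ≤-reflexive (trans (sym (∣⊤∣≡n n)) (sym (+-identityʳ _)))
  }
rootLabelling ((u , v) ∷ H) = addEdge (rootLabelling H) u v

Connected⇒n∸1≤∣E∣ : ∀ {n} (H : EdgeList n) → Connected H → n ∸ 1 ≤ length H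
Connected⇒n∸1≤∣E∣ {zero}  H connected = z≤n
Connected⇒n∸1≤∣E∣ {suc n} H connected =
  ≤-pred (≤-trans size (+-monoˡ-≤ (length H) ∣roots∣≤1))
  where
  open RootLabelling (rootLabelling H)

  roots⊆⁅label0⁆ : roots ⊆ˢ ⁅ label fzero ⁆
  roots⊆⁅label0⁆ {r} r∈ =
    subst (_∈ˢ ⁅ label fzero ⁆) (trans (sym (label-walk (connected r fzero))) (label-root r∈))
          (x∈⁅x⁆ (label fzero))

  ∣roots∣≤1 : ∣ roots ∣ ≤ 1
  ∣roots∣≤1 = ≤-trans (p⊆q⇒∣p∣≤∣q∣ roots⊆⁅label0⁆) (≤-reflexive (∣⁅x⁆∣≡1 (label fzero)))

Loopless : ∀ {n} → EdgeList n → Set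
Loopless E = All (λ e → proj₁ e ≢ proj₂ e) E

module _ {n} {T : EdgeList n} (loopless : Loopless T) (acyclic : Acyclic T) where

  Adj-irrefl : ∀ {a b} → Adj T a b → a ≢ b
  Adj-irrefl (inj₁ ab) = lookup loopless ab
  Adj-irrefl (inj₂ ba) = lookup loopless ba ∘ sym

  triangle-free : ∀ {x y z} → Adj T x y → Adj T y z → Adj T z x → ⊥
  triangle-free xy yz zx = acyclic (_ ∷ _ ∷ _ ∷ [])
    ( s≤s (s≤s (s≤s z≤n))
    , (Adj-irrefl xy ∷ Adj-irrefl (Adj-sym zx) ∷ []) ∷ (Adj-irrefl yz ∷ []) ∷ [] ∷ []
    , xy , yz , zx )

  common-neighbour-unique : ∀ {x y z z′} → x ≢ y →
    Adj T x z → Adj T y z → Adj T x z′ → Adj T y z′ → z ≡ z′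
  common-neighbour-unique {z = z} {z′} x≢y xz yz xz′ yz′ with z ≟ z′
  ... | yes z≡z′ = z≡z′
  ... | no  z≢z′ = ⊥-elim (acyclic (_ ∷ _ ∷ _ ∷ _ ∷ [])
    ( s≤s (s≤s (s≤s z≤n))
    , (Adj-irrefl xz ∷ x≢y ∷ Adj-irrefl xz′ ∷ []) ∷ (Adj-irrefl (Adj-sym yz) ∷ z≢z′ ∷ [])
        ∷ (Adj-irrefl yz′ ∷ []) ∷ [] ∷ []
    , xz , Adj-sym yz , yz′ , Adj-sym xz′ ))

Adj-++⁻ : ∀ {n} (E : EdgeList n) {F a b} → Adj (E ++ F) a b → Adj E a b ⊎ Adj F a b
Adj-++⁻ E (inj₁ ab) = Data.Sum.map inj₁ inj₁ (∈-++⁻ E ab)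
Adj-++⁻ E (inj₂ ba) = Data.Sum.map inj₂ inj₂ (∈-++⁻ E ba)

module Shortcuts {n} (T : EdgeList n) where
  open DecMembership (≡-dec (_≟_ {n}) (_≟_ {n})) using (_∈?_)

  Adj? : ∀ a b → Dec (Adj T a b)
  Adj? a b = ((a , b) ∈? T) ⊎-dec ((b , a) ∈? T)

  shortcut : Fin n × Fin n → EdgeList n
  shortcut (x , y) with any? (λ z → Adj? x z ×-dec Adj? y z)
  ... | yes (z , _) = (x , z) ∷ (y , z) ∷ []
  ... | no  _       = (x , y) ∷ []

  shortcut-length : ∀ ℓ → length (shortcut ℓ) ≤ 2
  shortcut-length (x , y) with any? (λ z → Adj? x z ×-dec Adj? y z)
  ... | yes _ = ≤-refl
  ... | no  _ = s≤s z≤n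

  shortcuts-length : ∀ A → length (concatMap shortcut A) ≤ 2 * length A
  shortcuts-length []      = z≤n
  shortcuts-length (ℓ ∷ A) = begin
    length (shortcut ℓ ++ concatMap shortcut A)        ≡⟨ length-++ (shortcut ℓ) ⟩
    length (shortcut ℓ) + length (concatMap shortcut A) ≤⟨ +-mono-≤ (shortcut-length ℓ)
                                                                    (shortcuts-length A) ⟩
    2 + 2 * length A                                    ≡⟨ sym (*-suc 2 (length A)) ⟩
    2 * length (ℓ ∷ A)                                  ∎
    where open ≤-Reasoning

  shortcut-walk : ∀ x y → Walk (shortcut (x , y)) x y
  shortcut-walk x y with any? (λ z → Adj? x z ×-dec Adj? y z)
  ... | yes _ = step (inj₁ (here refl)) (step (inj₂ (there (here refl))) here)
  ... | no  _ = step (inj₁ (here refl)) here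

  module _ (loopless : Loopless T) (acyclic : Acyclic T) where

    shortcut-common-neighbour : ∀ {x y u} → x ≢ y → Adj T x u → Adj T y u →
      (x , u) ∈ shortcut (x , y) × (y , u) ∈ shortcut (x , y)
    shortcut-common-neighbour {x} {y} {u} x≢y xu yu
      with any? (λ z → Adj? x z ×-dec Adj? y z)
    ... | no  ∄z = ⊥-elim (∄z (u , xu , yu))
    ... | yes (z , xz , yz)
      with refl ← common-neighbour-unique loopless acyclic x≢y xz yz xu yu =
      here refl , there (here refl)

    module Covering (A : EdgeList n) where

      H : EdgeList n
      H = concatMap shortcut A

      shortcut⊆H : ∀ {ℓ} → ℓ ∈ A → shortcut ℓ ⊆ H
      shortcut⊆H ℓ∈A e∈ = ∈-concatMap⁺ shortcut (Any.map (λ { refl → e∈ }) ℓ∈A)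

      link-walk : ∀ {x y} → Adj A x y → Walk H x y
      link-walk {x} {y} (inj₁ xy) = Walk-mono (shortcut⊆H xy) (shortcut-walk x y)
      link-walk         (inj₂ yx) = reverseʷ (link-walk (inj₁ yx))

      link-common-neighbour : ∀ {x y u} → Adj A x y → x ≢ y → Adj T x u → Adj T y u →
        Adj H x u × Adj H y u
      link-common-neighbour (inj₁ xy) x≢y xu yu
        with xu∈ , yu∈ ← shortcut-common-neighbour x≢y xu yu =
        inj₁ (shortcut⊆H xy xu∈) , inj₁ (shortcut⊆H xy yu∈)
      link-common-neighbour (inj₂ yx) x≢y xu yu =
        swap (link-common-neighbour (inj₁ yx) (x≢y ∘ sym) yu xu)

      tree-edge-walk : ∀ {u v} → (u , v) ∈ T → InTriangle (T ++ A) (u , v) → Walk H u v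
      tree-edge-walk uv (w , w≢u , w≢v , uw , wv) with Adj-++⁻ T uw | Adj-++⁻ T wv
      ... | inj₁ uwᵀ | inj₁ wvᵀ =
        ⊥-elim (triangle-free loopless acyclic (inj₁ uv) (Adj-sym wvᵀ) (Adj-sym uwᵀ))
      ... | inj₁ uwᵀ | inj₂ wvᴬ =
        Adj⇒Walk (Adj-sym (proj₂ (link-common-neighbour wvᴬ w≢v (Adj-sym uwᵀ) (inj₂ uv))))
      ... | inj₂ uwᴬ | inj₁ wvᵀ =
        Adj⇒Walk (proj₁ (link-common-neighbour uwᴬ (w≢u ∘ sym) (inj₁ uv) wvᵀ))
      ... | inj₂ uwᴬ | inj₂ wvᴬ = link-walk uwᴬ ++ʷ link-walk wvᴬ

      tree-Adj-walk : All (InTriangle (T ++ A)) T → ∀ {a b} → Adj T a b → Walk H a b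
      tree-Adj-walk covered (inj₁ ab) = tree-edge-walk ab (lookup covered ab)
      tree-Adj-walk covered (inj₂ ba) = reverseʷ (tree-edge-walk ba (lookup covered ba))

mainTheorem12 : (n : ℕ) (I : Instance n) (A : EdgeList n) → Feasible I A →
                  n ∸ 1 ≤ 2 * length A
mainTheorem12 n I A (_ , _ , covered) =
  ≤-trans (Connected⇒n∸1≤∣E∣ H H-connected) (shortcuts-length A)
  where
  open Instance I
  loopless : Loopless T
  loopless = proj₁ (proj₁ isTree)

  connected : Connected T
  connected = proj₁ (proj₂ isTree)

  acyclic : Acyclic T
  acyclic = proj₂ (proj₂ isTree)

  open Shortcuts T
  open Covering loopless acyclic A

  H-connected : Connected H
  H-connected u v = Walk-bind (tree-Adj-walk covered) (connected u v)
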